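{- For any rooted tree $T$: $$M_T(x,y,1)=\frac{\partial}{\partial y}A_T(x,y),\qquad A_T(x,1-x)=1-p_T(x),\qquad M_T(x,1-x,x)=\frac{\mathrm d}{\mathrm dx}p_T(x).$$
   Context: Rooted tree: finite tree with a distinguished root. A leaf is a vertex with no children. For a rooted forest $F$, a leaf-induced subforest is a (possibly empty) union of paths from roots of $F$ to leaves of $F$; $P_F(x,y)=\sum_{F'}x^{|V(F')|}y^{|L(F')|}$ over leaf-induced subforests $F'$ (vertex and leaf counts), and $p_T(x):=1-P_T(x,-1)$ for a rooted tree $T$. A subtree of $T$ is the empty subgraph or a connected subgraph containing the root (identified with its vertex set); it is admissible if it is empty or contains no leaf of $T$; $\mathscr A(T)$ is the set of admissible subtrees. For a vertex set $S$, $\partial S$ is the set of vertices adjacent to $S$ but not in $S$, with $\partial\emptyset=\{\text{root}\}$. $A_T(x,y)=\sum_{T'\in\mathscr A(T)}x^{|T'|}y^{|\partial T'|}$. For a vertex $v$, $T_v$ is the fringe subtree of $v$ and its descendants rooted at $v$, and $p_v:=p_{T_v}$. $M_T(x,y,z)=\sum_{T'\in\mathscr A(T)}x^{|T'|}y^{|\partial T'|-1}\sum_{v\in\partial T'}\frac{1}{z}p_v(z)$. -}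

module Defs where

open import Level using (Level)
open import Data.Bool using (Bool; true; false; _∧_; not)
open import Data.Nat as ℕ using (ℕ; zero; suc; _∸_)
open import Data.Integer as ℤ using (ℤ; +_; -[1+_])
open import Data.Fin using (Fin)
open import Data.Vec as Vec using (Vec; []; _∷_)
open import Data.List as List using (List; []; _∷_; map; concatMap; filter; length)
open import Data.Maybe using (Maybe; just; nothing)
open import Data.Product using (_×_; _,_)
open import Algebra.Bundles using (CommutativeRing)

-- Formal multivariate polynomials over ℤ in n variables, as finite sums
-- of monomials  c · X₀^e₀ ⋯ X_{n-1}^e_{n-1}.

Mono : ℕ → Set
Mono n = ℤ × Vec ℕ n

Poly : ℕ → Set
Poly n = List (Mono n)

constP : ∀ {n} → ℤ → Poly n
constP {n} c = (c , Vec.replicate n 0) ∷ []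

_⊕_ : ∀ {n} → Poly n → Poly n → Poly n
p ⊕ q = p List.++ q

⊖_ : ∀ {n} → Poly n → Poly n
⊖ p = map (λ { (c , e) → (ℤ.- c , e) }) p

_⊝_ : ∀ {n} → Poly n → Poly n → Poly n
p ⊝ q = p ⊕ (⊖ q)

_⊗_ : ∀ {n} → Poly n → Poly n → Poly n
p ⊗ q = concatMap (λ { (c , e) → map (λ { (d , f) → (c ℤ.* d , Vec.zipWith ℕ._+_ e f) }) q }) p

ΣP : ∀ {n} {A : Set} → List A → (A → Poly n) → Poly n
ΣP xs f = concatMap f xs

∂ : ∀ {n} → Fin n → Poly n → Poly n
∂ i = map (λ { (c , e) → (c ℤ.* (+ Vec.lookup e i) , Vec.updateAt e i (λ k → k ∸ 1)) })

-- formal division by the variable X_i, for a polynomial divisible by X_i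
-- (i.e. whose monomials with X_i-exponent 0 sum to zero): those monomials
-- are dropped and the others have their X_i-exponent lowered by one.
divVar : ∀ {n} → Fin n → Poly n → Poly n
divVar i [] = []
divVar i ((c , e) ∷ p) with Vec.lookup e i
... | zero  = divVar i p
... | suc k = (c , Vec.updateAt e i (λ _ → k)) ∷ divVar i p

module Eval {c ℓ : Level} (R : CommutativeRing c ℓ) where
  open CommutativeRing R public using (Carrier; _≈_; _+_; _*_; -_; 0#; 1#)

  natR : ℕ → Carrier
  natR zero    = 0#
  natR (suc n) = 1# + natR n

  intR : ℤ → Carrier
  intR (+ n)     = natR n
  intR -[1+ n ]  = - natR (suc n)

  pow : Carrier → ℕ → Carrier
  pow x zero    = 1#
  pow x (suc k) = x * pow x k

  monoVal : ∀ {n} → Vec ℕ n → Vec Carrier n → Carrier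
  monoVal []       []       = 1#
  monoVal (e ∷ es) (x ∷ xs) = pow x e * monoVal es xs

  eval : ∀ {n} → Poly n → Vec Carrier n → Carrier
  eval []             xs = 0#
  eval ((k , e) ∷ p)  xs = intR k * monoVal e xs + eval p xs

data Tree : Set where
  node : List Tree → Tree

-- Nonempty connected subgraphs containing the root (Rt t), described by:
-- the root is included, and each child is either excluded (nothing) or
-- included together with a connected subgraph of its fringe subtree
-- containing it.
mutual
  data Rt : Tree → Set where
    rt : ∀ {ts} → Ch ts → Rt (node ts)

  data Ch : List Tree → Set where
    []  : Ch []
    _∷_ : ∀ {t ts} → Maybe (Rt t) → Ch ts → Ch (t ∷ ts)

-- A subtree of T: the empty subgraph (nothing) or a nonempty one.
Subtree : Tree → Set
Subtree t = Maybe (Rt t)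

mutual
  allRt : (t : Tree) → List (Rt t)
  allRt (node ts) = map rt (allCh ts)

  allCh : (ts : List Tree) → List (Ch ts)
  allCh []       = [] ∷ []
  allCh (t ∷ ts) = concatMap (λ m → map (m ∷_) (allCh ts)) (nothing ∷ map just (allRt t))

allSubtrees : (t : Tree) → List (Subtree t)
allSubtrees t = nothing ∷ map just (allRt t)

mutual
  sizeRt : ∀ {t} → Rt t → ℕ
  sizeRt (rt cs) = suc (sizeCh cs)

  sizeCh : ∀ {ts} → Ch ts → ℕ
  sizeCh []             = 0
  sizeCh (nothing ∷ cs) = sizeCh cs
  sizeCh (just r ∷ cs)  = sizeRt r ℕ.+ sizeCh cs

size : ∀ {t} → Subtree t → ℕ
size nothing  = 0
size (just r) = sizeRt r

-- The boundary ∂T' (vertices adjacent to T' but not in T'), listed by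
-- their fringe subtrees T_v.  These are exactly the excluded children of
-- included vertices; ∂∅ = {root}.
mutual
  bdRt : ∀ {t} → Rt t → List Tree
  bdRt (rt cs) = bdCh cs

  bdCh : ∀ {ts} → Ch ts → List Tree
  bdCh []                        = []
  bdCh (_∷_ {t = t} nothing cs)  = t ∷ bdCh cs
  bdCh (just r ∷ cs)             = bdRt r List.++ bdCh cs

boundary : ∀ {t} → Subtree t → List Tree
boundary {t} nothing  = t ∷ []
boundary     (just r) = bdRt r

mutual
  noLeafRt : ∀ {t} → Rt t → Bool
  noLeafRt (rt [])         = false
  noLeafRt (rt (c ∷ cs))   = noLeafCh (c ∷ cs)

  noLeafCh : ∀ {ts} → Ch ts → Bool
  noLeafCh []             = true
  noLeafCh (nothing ∷ cs) = noLeafCh cs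
  noLeafCh (just r ∷ cs)  = noLeafRt r ∧ noLeafCh cs

admissible : ∀ {t} → Subtree t → Bool
admissible nothing  = true
admissible (just r) = noLeafRt r

allAdmissible : (t : Tree) → List (Subtree t)
allAdmissible t = filter (λ s → Data.Bool._≟_ (admissible s) true) (allSubtrees t)
  where import Data.Bool

mutual
  anyInclCh : ∀ {ts} → Ch ts → Bool
  anyInclCh []             = false
  anyInclCh (nothing ∷ cs) = anyInclCh cs
  anyInclCh (just _ ∷ cs)  = true

  leavesRt : ∀ {t} → Rt t → ℕ
  leavesRt (rt cs) with anyInclCh cs
  ... | false = 1
  ... | true  = leavesCh cs

  leavesCh : ∀ {ts} → Ch ts → ℕ
  leavesCh []             = 0
  leavesCh (nothing ∷ cs) = leavesCh cs
  leavesCh (just r ∷ cs)  = leavesRt r ℕ.+ leavesCh cs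

-- A union of root-to-leaf paths of T is exactly a subtree every leaf of
-- which is a leaf of T: every included vertex with no included child must
-- have no children in T.
mutual
  leafIndRt : ∀ {t} → Rt t → Bool
  leafIndRt (rt [])       = true
  leafIndRt (rt (c ∷ cs)) = anyInclCh (c ∷ cs) ∧ leafIndCh (c ∷ cs)

  leafIndCh : ∀ {ts} → Ch ts → Bool
  leafIndCh []             = true
  leafIndCh (nothing ∷ cs) = leafIndCh cs
  leafIndCh (just r ∷ cs)  = leafIndRt r ∧ leafIndCh cs

leafInduced : ∀ {t} → Subtree t → Bool
leafInduced nothing  = true
leafInduced (just r) = leafIndRt r

allLeafInduced : (t : Tree) → List (Subtree t)
allLeafInduced t = filter (λ s → Data.Bool._≟_ (leafInduced s) true) (allSubtrees t)
  where import Data.Bool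

leaves : ∀ {t} → Subtree t → ℕ
leaves nothing  = 0
leaves (just r) = leavesRt r

mono2 : ℕ → ℕ → Poly 2
mono2 a b = (+ 1 , a ∷ b ∷ []) ∷ []

P : Tree → Poly 2
P t = ΣP (allLeafInduced t) (λ F → mono2 (size F) (leaves F))

substY : ℤ → Poly 2 → Poly 1
substY k = map (λ { (c , a ∷ b ∷ []) → (c ℤ.* (k ℤ.^ b) , a ∷ []) })

p : Tree → Poly 1
p t = constP (+ 1) ⊝ substY (ℤ.- (+ 1)) (P t)

A : Tree → Poly 2
A t = ΣP (allAdmissible t) (λ T' → mono2 (size T') (length (boundary T')))

inZ : Poly 1 → Poly 3
inZ = map (λ { (c , e ∷ []) → (c , 0 ∷ 0 ∷ e ∷ []) })

-- M_T(x,y,z) = Σ_{T' admissible} x^{|T'|} y^{|∂T'|-1} Σ_{v ∈ ∂T'} (1/z) p_v(z)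
M : Tree → Poly 3
M t = ΣP (allAdmissible t) (λ T' →
        ((+ 1 , size T' ∷ (length (boundary T') ∸ 1) ∷ 0 ∷ []) ∷ [])
        ⊗ ΣP (boundary T') (λ v → inZ (divVar Data.Fin.zero (p v))))

-- Each of A, P and M is a sum over subtrees T' of T of a weight that factors over the
-- children of the root: sizes and boundaries of T' are additive over the children, and
-- the inner boundary sum of M splits by a Leibniz rule.  Summing over subtrees therefore
-- turns the generating functions into recursions along the tree:
--   A = y + x ∏ A_children,   P = 1 + x Q  with  Q = ∏ P_children − 1,
--   M = p(z)/z + x ∂∏(A, M),  with y as the value of A and Q at a single vertex.
-- At z = 1 one gets Q(1, −1) = −1, so every p_v(1)/1 equals 1 and the inner sum of M counts
-- the boundary, which is ∂A/∂y.  On the line y = 1 − x, A(x, y) satisfies the recursion of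
-- P(x, −1) = 1 − p(x), and M(x, y, x) that of −∂ₓP(x, −1) = p′(x).

module Submission where

open import Defs
open import Level using (Level)
open import Algebra.Bundles using (CommutativeRing)
open import Algebra.Solver.Ring.AlmostCommutativeRing using (fromCommutativeRing; _-Raw-AlmostCommutative⟶_)
open import Data.Bool using (Bool; true; false; _∧_)
import Data.Bool
open import Data.Fin using (zero; suc)
open import Data.Integer as ℤ using (ℤ; +_; -[1+_])
import Data.Integer.Properties as ℤ
open import Data.List using (List; []; _∷_; _++_; map; concatMap; filter; length)
open import Data.List.Properties using (length-++)
open import Data.Maybe using (Maybe; just; nothing)
open import Data.Nat as ℕ using (ℕ; zero; suc; _∸_)
import Data.Nat.Properties as ℕ
open import Data.Product using (_×_; _,_)
open import Data.Sign as Sign using (Sign)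
open import Data.Vec as Vec using (Vec; []; _∷_)
open import Relation.Binary.PropositionalEquality as ≡ using (_≡_)
open import Relation.Nullary using (yes; no)

genPoly : {A : Set} → (A → ℕ) → (A → ℕ) → List A → Poly 2
genPoly F G as = ΣP as (λ a → mono2 (F a) (G a))

module _ {c ℓ : Level} (R : CommutativeRing c ℓ) where

  open CommutativeRing R hiding (zero)
  open Eval R using (natR; intR; pow; monoVal; eval)
  open import Algebra.Properties.AbelianGroup +-abelianGroup using (⁻¹-∙-comm)
  open import Algebra.Properties.CommutativeSemigroup +-commutativeSemigroup using (interchange)
  open import Algebra.Properties.CommutativeSemigroup *-commutativeSemigroup using () renaming (interchange to interchangeᵐ)
  open import Algebra.Properties.Group +-group using (ε⁻¹≈ε; ⁻¹-involutive)
  open import Algebra.Properties.Ring ring using (-1*x≈-x; -‿distribʳ-*)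
  open import Algebra.Properties.Semiring.Mult semiring using (×-homo-+; ×1-homo-*) renaming (_×_ to _×ₙ_)
  open import Algebra.Properties.Semiring.Exp semiring using (_^_; ^-homo-*)
  open import Relation.Binary.Reasoning.Setoid setoid

  natR≡×1# : ∀ n → natR n ≡ n ×ₙ 1#
  natR≡×1# zero    = ≡.refl
  natR≡×1# (suc n) = ≡.cong (_+_ 1#) (natR≡×1# n)

  natR-+ : ∀ m n → natR (m ℕ.+ n) ≈ natR m + natR n
  natR-+ m n rewrite natR≡×1# (m ℕ.+ n) | natR≡×1# m | natR≡×1# n = ×-homo-+ 1# m n

  natR-* : ∀ m n → natR (m ℕ.* n) ≈ natR m * natR n
  natR-* m n rewrite natR≡×1# (m ℕ.* n) | natR≡×1# m | natR≡×1# n = ×1-homo-* m n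

  pow≡^ : ∀ x n → pow x n ≡ x ^ n
  pow≡^ x zero    = ≡.refl
  pow≡^ x (suc n) = ≡.cong (x *_) (pow≡^ x n)

  pow-+ : ∀ x m n → pow x (m ℕ.+ n) ≈ pow x m * pow x n
  pow-+ x m n rewrite pow≡^ x (m ℕ.+ n) | pow≡^ x m | pow≡^ x n = ^-homo-* x m n

  intR-⊖ : ∀ m n → intR (m ℤ.⊖ n) ≈ natR m + - natR n
  intR-⊖ m       zero    = sym (trans (+-congˡ ε⁻¹≈ε) (+-identityʳ _))
  intR-⊖ zero    (suc n) = sym (+-identityˡ _)
  intR-⊖ (suc m) (suc n) = begin
    intR (suc m ℤ.⊖ suc n)        ≡⟨ ≡.cong intR (ℤ.[1+m]⊖[1+n]≡m⊖n m n) ⟩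
    intR (m ℤ.⊖ n)                ≈⟨ intR-⊖ m n ⟩
    natR m + - natR n             ≈⟨ +-identityˡ _ ⟨
    0# + (natR m + - natR n)      ≈⟨ +-congʳ (-‿inverseʳ 1#) ⟨
    (1# + - 1#) + (natR m + - natR n) ≈⟨ interchange 1# (- 1#) (natR m) (- natR n) ⟩
    (1# + natR m) + (- 1# + - natR n) ≈⟨ +-congˡ (⁻¹-∙-comm 1# (natR n)) ⟩
    natR (suc m) + - natR (suc n) ∎

  intR-+ : ∀ i j → intR (i ℤ.+ j) ≈ intR i + intR j
  intR-+ -[1+ m ] -[1+ n ] = begin
    - natR (suc (suc (m ℕ.+ n)))     ≡⟨ ≡.cong (λ k → - natR (suc k)) (ℕ.+-suc m n) ⟨
    - natR (suc m ℕ.+ suc n)         ≈⟨ -‿cong (natR-+ (suc m) (suc n)) ⟩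
    - (natR (suc m) + natR (suc n))  ≈⟨ ⁻¹-∙-comm _ _ ⟨
    - natR (suc m) + - natR (suc n)  ∎
  intR-+ -[1+ m ] (+ n)    = trans (intR-⊖ n (suc m)) (+-comm _ _)
  intR-+ (+ m)    -[1+ n ] = intR-⊖ m (suc n)
  intR-+ (+ m)    (+ n)    = natR-+ m n

  intR-neg : ∀ i → intR (ℤ.- i) ≈ - intR i
  intR-neg -[1+ n ]     = sym (⁻¹-involutive _)
  intR-neg (+ zero)     = sym ε⁻¹≈ε
  intR-neg (+ (suc n))  = refl

  intR-1 : intR (+ 1) ≈ 1#
  intR-1 = +-identityʳ _

  signR : Sign → Carrier
  signR Sign.+ = 1#
  signR Sign.- = - 1#

  signR-* : ∀ s t → signR (s Sign.* t) ≈ signR s * signR t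
  signR-* Sign.+ t      = sym (*-identityˡ _)
  signR-* Sign.- Sign.+ = sym (*-identityʳ _)
  signR-* Sign.- Sign.- = sym (trans (-1*x≈-x _) (⁻¹-involutive _))

  intR-◃ : ∀ s n → intR (s ℤ.◃ n) ≈ signR s * natR n
  intR-◃ s      zero    = sym (zeroʳ _)
  intR-◃ Sign.+ (suc n) = sym (*-identityˡ _)
  intR-◃ Sign.- (suc n) = sym (-1*x≈-x _)

  intR-sign-abs : ∀ i → intR i ≈ signR (ℤ.sign i) * natR ℤ.∣ i ∣
  intR-sign-abs i = trans (reflexive (≡.cong intR (≡.sym (ℤ.◃-inverse i)))) (intR-◃ (ℤ.sign i) ℤ.∣ i ∣)

  intR-* : ∀ i j → intR (i ℤ.* j) ≈ intR i * intR j
  intR-* i j = begin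
    intR (i ℤ.* j)
      ≈⟨ intR-◃ (ℤ.sign i Sign.* ℤ.sign j) (ℤ.∣ i ∣ ℕ.* ℤ.∣ j ∣) ⟩
    signR (ℤ.sign i Sign.* ℤ.sign j) * natR (ℤ.∣ i ∣ ℕ.* ℤ.∣ j ∣)
      ≈⟨ *-cong (signR-* (ℤ.sign i) (ℤ.sign j)) (natR-* ℤ.∣ i ∣ ℤ.∣ j ∣) ⟩
    (signR (ℤ.sign i) * signR (ℤ.sign j)) * (natR ℤ.∣ i ∣ * natR ℤ.∣ j ∣)
      ≈⟨ interchangeᵐ _ _ _ _ ⟩
    (signR (ℤ.sign i) * natR ℤ.∣ i ∣) * (signR (ℤ.sign j) * natR ℤ.∣ j ∣)
      ≈⟨ *-cong (intR-sign-abs i) (intR-sign-abs j) ⟨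
    intR i * intR j ∎

  intR-morphism : ℤ.+-*-rawRing -Raw-AlmostCommutative⟶ fromCommutativeRing R
  intR-morphism = record
    { ⟦_⟧ = intR ; +-homo = intR-+ ; *-homo = intR-* ; -‿homo = intR-neg
    ; 0-homo = refl ; 1-homo = intR-1 }

  intR-≟ : ∀ i j → Maybe (intR i ≈ intR j)
  intR-≟ i j with i ℤ.≟ j
  ... | yes ≡.refl = just refl
  ... | no _       = nothing

  -- With ℤ as coefficient ring the normaliser can cancel terms such as x + - x.
  open import Algebra.Solver.Ring ℤ.+-*-rawRing (fromCommutativeRing R) intR-morphism intR-≟
    using (solve; _:=_; _:+_; _:*_; :-_; con)

  intR-^ : ∀ k b → intR (k ℤ.^ b) ≈ pow (intR k) b
  intR-^ k zero    = +-identityʳ _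
  intR-^ k (suc b) = trans (intR-* k (k ℤ.^ b)) (*-congˡ (intR-^ k b))

  intR-substY : ∀ k b → intR (ℤ.- (+ 1 ℤ.* k ℤ.^ b)) ≈ - pow (intR k) b
  intR-substY k b = begin
    intR (ℤ.- (+ 1 ℤ.* k ℤ.^ b))  ≈⟨ intR-neg (+ 1 ℤ.* k ℤ.^ b) ⟩
    - intR (+ 1 ℤ.* k ℤ.^ b)      ≈⟨ -‿cong (intR-* (+ 1) (k ℤ.^ b)) ⟩
    - (intR (+ 1) * intR (k ℤ.^ b)) ≈⟨ -‿cong (*-cong intR-1 (intR-^ k b)) ⟩
    - (1# * pow (intR k) b)       ≈⟨ -‿cong (*-identityˡ _) ⟩
    - pow (intR k) b              ∎

  divPow : Carrier → ℕ → Carrier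
  divPow x zero    = 0#
  divPow x (suc n) = pow x n

  pow-length-++ : ∀ {A : Set} y (L L′ : List A) → pow y (length (L ++ L′)) ≈ pow y (length L) * pow y (length L′)
  pow-length-++ y L L′ = trans (reflexive (≡.cong (pow y) (length-++ L))) (pow-+ y (length L) (length L′))

  pow′ : Carrier → ℕ → Carrier
  pow′ x n = natR n * pow x (n ∸ 1)

  pow′-zero : ∀ x → pow′ x 0 ≈ 0#
  pow′-zero x = zeroˡ _

  pow′-suc : ∀ x n → pow′ x (suc n) ≈ pow x n + x * pow′ x n
  pow′-suc x zero = begin
    (1# + 0#) * 1#         ≈⟨ *-identityʳ _ ⟩
    1# + 0#                ≈⟨ +-congˡ (trans (*-congˡ (zeroˡ _)) (zeroʳ _)) ⟨
    1# + x * (0# * 1#)     ∎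
  pow′-suc x (suc n) = begin
    (1# + natR (suc n)) * (x * pow x n)
      ≈⟨ distribʳ _ _ _ ⟩
    1# * (x * pow x n) + natR (suc n) * (x * pow x n)
      ≈⟨ +-cong (*-identityˡ _) (solve 3 (λ a b d → a :* (b :* d) := b :* (a :* d)) refl _ _ _) ⟩
    x * pow x n + x * (natR (suc n) * pow x n) ∎

  pow′-+ : ∀ x m n → pow′ x (m ℕ.+ n) ≈ pow′ x m * pow x n + pow x m * pow′ x n
  pow′-+ x zero    n = sym (trans (+-cong (trans (*-congʳ (pow′-zero x)) (zeroˡ _)) (*-identityˡ _)) (+-identityˡ _))
  pow′-+ x (suc m) n = begin
    pow′ x (suc (m ℕ.+ n))
      ≈⟨ pow′-suc x (m ℕ.+ n) ⟩
    pow x (m ℕ.+ n) + x * pow′ x (m ℕ.+ n)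
      ≈⟨ +-cong (pow-+ x m n) (*-congˡ (pow′-+ x m n)) ⟩
    pow x m * pow x n + x * (pow′ x m * pow x n + pow x m * pow′ x n)
      ≈⟨ solve 5 (λ a b z d e → a :* b :+ z :* (d :* b :+ a :* e) := (a :+ z :* d) :* b :+ (z :* a) :* e) refl _ _ _ _ _ ⟩
    (pow x m + x * pow′ x m) * pow x n + (x * pow x m) * pow′ x n
      ≈⟨ +-congʳ (*-congʳ (pow′-suc x m)) ⟨
    pow′ x (suc m) * pow x n + pow x (suc m) * pow′ x n ∎

  -- Sums over lists and over subtrees

  ∑ : {A : Set} → List A → (A → Carrier) → Carrier
  ∑ []       f = 0#
  ∑ (a ∷ as) f = f a + ∑ as f

  syntax ∑ as (λ a → e) = ∑[ a ∈ as ] e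

  𝟙 : Bool → Carrier
  𝟙 true  = 1#
  𝟙 false = 0#

  𝟙-∧ : ∀ a b → 𝟙 (a ∧ b) ≈ 𝟙 a * 𝟙 b
  𝟙-∧ true  b = sym (*-identityˡ _)
  𝟙-∧ false b = sym (zeroˡ _)

  module _ {A : Set} where

    ∑-cong : (as : List A) {f g : A → Carrier} → (∀ a → f a ≈ g a) → ∑ as f ≈ ∑ as g
    ∑-cong []       f≈g = refl
    ∑-cong (a ∷ as) f≈g = +-cong (f≈g a) (∑-cong as f≈g)

    ∑-++ : (as bs : List A) (f : A → Carrier) → ∑ (as ++ bs) f ≈ ∑ as f + ∑ bs f
    ∑-++ []       bs f = sym (+-identityˡ _)
    ∑-++ (a ∷ as) bs f = trans (+-congˡ (∑-++ as bs f)) (sym (+-assoc _ _ _))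

    ∑-*ˡ : (as : List A) (k : Carrier) (f : A → Carrier) → ∑[ a ∈ as ] (k * f a) ≈ k * ∑ as f
    ∑-*ˡ []       k f = sym (zeroʳ _)
    ∑-*ˡ (a ∷ as) k f = trans (+-congˡ (∑-*ˡ as k f)) (sym (distribˡ _ _ _))

    ∑-*ʳ : (as : List A) (k : Carrier) (f : A → Carrier) → ∑[ a ∈ as ] (f a * k) ≈ ∑ as f * k
    ∑-*ʳ []       k f = sym (zeroˡ _)
    ∑-*ʳ (a ∷ as) k f = trans (+-congˡ (∑-*ʳ as k f)) (sym (distribʳ _ _ _))

    ∑-+ : (as : List A) (f g : A → Carrier) → ∑[ a ∈ as ] (f a + g a) ≈ ∑ as f + ∑ as g
    ∑-+ []       f g = sym (+-identityˡ _)
    ∑-+ (a ∷ as) f g = trans (+-congˡ (∑-+ as f g)) (interchange _ _ _ _)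

    ∑-neg : (as : List A) (f : A → Carrier) → ∑[ a ∈ as ] (- f a) ≈ - ∑ as f
    ∑-neg []       f = sym ε⁻¹≈ε
    ∑-neg (a ∷ as) f = trans (+-congˡ (∑-neg as f)) (⁻¹-∙-comm _ _)

    ∑-0# : (as : List A) → ∑[ a ∈ as ] 0# ≈ 0#
    ∑-0# []       = refl
    ∑-0# (a ∷ as) = trans (+-identityˡ _) (∑-0# as)

    ∑-1# : (as : List A) {f : A → Carrier} → (∀ a → f a ≈ 1#) → ∑ as f ≈ natR (length as)
    ∑-1# []       f≈1 = refl
    ∑-1# (a ∷ as) f≈1 = +-cong (f≈1 a) (∑-1# as f≈1)

    ∑-filter : (as : List A) (b : A → Bool) (f : A → Carrier) →
      ∑ (filter (λ a → Data.Bool._≟_ (b a) true) as) f ≈ ∑[ a ∈ as ] (𝟙 (b a) * f a)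
    ∑-filter []       b f = refl
    ∑-filter (a ∷ as) b f with b a
    ... | true  = +-cong (sym (*-identityˡ _)) (∑-filter as b f)
    ... | false = trans (∑-filter as b f) (trans (sym (+-identityˡ _)) (+-congʳ (sym (zeroˡ _))))

  module _ {A B : Set} where

    ∑-map : (as : List A) (g : A → B) (f : B → Carrier) → ∑ (map g as) f ≈ ∑[ a ∈ as ] f (g a)
    ∑-map []       g f = refl
    ∑-map (a ∷ as) g f = +-congˡ (∑-map as g f)

    ∑-concatMap : (as : List A) (h : A → List B) (f : B → Carrier) →
      ∑ (concatMap h as) f ≈ ∑[ a ∈ as ] ∑ (h a) f
    ∑-concatMap []       h f = refl
    ∑-concatMap (a ∷ as) h f = trans (∑-++ (h a) (concatMap h as) f) (+-congˡ (∑-concatMap as h f))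

  Weight : Set c
  Weight = ∀ {t} → Subtree t → Carrier

  ∑-subtrees : Tree → Weight → Carrier
  ∑-subtrees t f = ∑ (allSubtrees t) f

  ∑-subtrees-node : ∀ ts (f : Weight) →
    ∑-subtrees (node ts) f ≈ f nothing + ∑[ cs ∈ allCh ts ] f (just (rt cs))
  ∑-subtrees-node ts f =
    +-congˡ (trans (∑-map (map rt (allCh ts)) just f) (∑-map (allCh ts) rt (λ r → f (just r))))

  ∑-allCh-∷ : ∀ t ts (h : Ch (t ∷ ts) → Carrier) →
    ∑ (allCh (t ∷ ts)) h ≈ ∑[ m ∈ allSubtrees t ] ∑[ cs ∈ allCh ts ] h (m ∷ cs)
  ∑-allCh-∷ t ts h = trans (∑-concatMap (allSubtrees t) (λ m → map (m ∷_) (allCh ts)) h)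
    (∑-cong (allSubtrees t) (λ m → ∑-map (allCh ts) (m ∷_) h))

  ∏ : List Tree → (Tree → Carrier) → Carrier
  ∏ []       F = 1#
  ∏ (t ∷ ts) F = F t * ∏ ts F

  ∂∏ : List Tree → (Tree → Carrier) → (Tree → Carrier) → Carrier
  ∂∏ []       F F′ = 0#
  ∂∏ (t ∷ ts) F F′ = F′ t * ∏ ts F + F t * ∂∏ ts F F′

  ∏-1# : (ts : List Tree) {F : Tree → Carrier} → (∀ t → F t ≈ 1#) → ∏ ts F ≈ 1#
  ∏-1# []       F≈1 = refl
  ∏-1# (t ∷ ts) F≈1 = trans (*-cong (F≈1 t) (∏-1# ts F≈1)) (*-identityˡ _)

  ∏ch : Weight → ∀ {ts} → Ch ts → Carrier
  ∏ch f []       = 1#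
  ∏ch f (m ∷ cs) = f m * ∏ch f cs

  ∂∏ch : Weight → Weight → ∀ {ts} → Ch ts → Carrier
  ∂∏ch f f′ []       = 0#
  ∂∏ch f f′ (m ∷ cs) = f′ m * ∏ch f cs + f m * ∂∏ch f f′ cs

  ∑-∏ch : (f : Weight) (ts : List Tree) → ∑ (allCh ts) (∏ch f) ≈ ∏ ts (λ t → ∑-subtrees t f)
  ∑-∏ch f []       = +-identityʳ _
  ∑-∏ch f (t ∷ ts) = begin
    ∑ (allCh (t ∷ ts)) (∏ch f)
      ≈⟨ ∑-allCh-∷ t ts (∏ch f) ⟩
    ∑[ m ∈ allSubtrees t ] ∑[ cs ∈ allCh ts ] (f m * ∏ch f cs)
      ≈⟨ ∑-cong (allSubtrees t) (λ m → ∑-*ˡ (allCh ts) (f m) (∏ch f)) ⟩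
    ∑[ m ∈ allSubtrees t ] (f m * ∑ (allCh ts) (∏ch f))
      ≈⟨ ∑-*ʳ (allSubtrees t) _ f ⟩
    ∑-subtrees t f * ∑ (allCh ts) (∏ch f)
      ≈⟨ *-congˡ (∑-∏ch f ts) ⟩
    ∑-subtrees t f * ∏ ts (λ t → ∑-subtrees t f) ∎

  ∑-∂∏ch : (f f′ : Weight) (ts : List Tree) →
    ∑ (allCh ts) (∂∏ch f f′) ≈ ∂∏ ts (λ t → ∑-subtrees t f) (λ t → ∑-subtrees t f′)
  ∑-∂∏ch f f′ []       = +-identityʳ _
  ∑-∂∏ch f f′ (t ∷ ts) = begin
    ∑ (allCh (t ∷ ts)) (∂∏ch f f′)
      ≈⟨ ∑-allCh-∷ t ts (∂∏ch f f′) ⟩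
    ∑[ m ∈ allSubtrees t ] ∑[ cs ∈ allCh ts ] (f′ m * ∏ch f cs + f m * ∂∏ch f f′ cs)
      ≈⟨ ∑-cong (allSubtrees t) (λ m → trans (∑-+ (allCh ts) _ _)
           (+-cong (∑-*ˡ (allCh ts) (f′ m) (∏ch f)) (∑-*ˡ (allCh ts) (f m) (∂∏ch f f′)))) ⟩
    ∑[ m ∈ allSubtrees t ] (f′ m * ∑ (allCh ts) (∏ch f) + f m * ∑ (allCh ts) (∂∏ch f f′))
      ≈⟨ trans (∑-+ (allSubtrees t) _ _) (+-cong (∑-*ʳ (allSubtrees t) _ f′) (∑-*ʳ (allSubtrees t) _ f)) ⟩
    ∑-subtrees t f′ * ∑ (allCh ts) (∏ch f) + ∑-subtrees t f * ∑ (allCh ts) (∂∏ch f f′)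
      ≈⟨ +-cong (*-congˡ (∑-∏ch f ts)) (*-congˡ (∑-∂∏ch f f′ ts)) ⟩
    ∂∏ (t ∷ ts) (λ t → ∑-subtrees t f) (λ t → ∑-subtrees t f′) ∎

  monoVal-zipWith-+ : ∀ {n} (e f : Vec ℕ n) (xs : Vec Carrier n) →
    monoVal (Vec.zipWith ℕ._+_ e f) xs ≈ monoVal e xs * monoVal f xs
  monoVal-zipWith-+ []      []      []       = sym (*-identityˡ _)
  monoVal-zipWith-+ (a ∷ e) (b ∷ f) (x ∷ xs) =
    trans (*-cong (pow-+ x a b) (monoVal-zipWith-+ e f xs)) (interchangeᵐ _ _ _ _)

  module _ {n : ℕ} where

    eval-++ : (p q : Poly n) (xs : Vec Carrier n) → eval (p ++ q) xs ≈ eval p xs + eval q xs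
    eval-++ []            q xs = sym (+-identityˡ _)
    eval-++ ((k , e) ∷ p) q xs = trans (+-congˡ (eval-++ p q xs)) (sym (+-assoc _ _ _))

    eval-ΣP : {A : Set} (as : List A) (f : A → Poly n) (xs : Vec Carrier n) →
      eval (ΣP as f) xs ≈ ∑[ a ∈ as ] eval (f a) xs
    eval-ΣP []       f xs = refl
    eval-ΣP (a ∷ as) f xs = trans (eval-++ (f a) (ΣP as f) xs) (+-congˡ (eval-ΣP as f xs))

    eval-monomial-⊗ : (k : ℤ) (e : Vec ℕ n) (q : Poly n) (xs : Vec Carrier n) →
      eval (((k , e) ∷ []) ⊗ q) xs ≈ (intR k * monoVal e xs) * eval q xs
    eval-monomial-⊗ k e []            xs = sym (zeroʳ _)
    eval-monomial-⊗ k e ((d , f) ∷ q) xs = begin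
      intR (k ℤ.* d) * monoVal (Vec.zipWith ℕ._+_ e f) xs + eval (((k , e) ∷ []) ⊗ q) xs
        ≈⟨ +-cong (*-cong (intR-* k d) (monoVal-zipWith-+ e f xs)) (eval-monomial-⊗ k e q xs) ⟩
      (intR k * intR d) * (monoVal e xs * monoVal f xs) + (intR k * monoVal e xs) * eval q xs
        ≈⟨ solve 5 (λ a b c d g → (a :* b) :* (c :* d) :+ (a :* c) :* g := (a :* c) :* (b :* d :+ g))
                 refl (intR k) (intR d) (monoVal e xs) (monoVal f xs) (eval q xs) ⟩
      (intR k * monoVal e xs) * (intR d * monoVal f xs + eval q xs) ∎

  eval-inZ : (q : Poly 1) (x y z : Carrier) → eval (inZ q) (x ∷ y ∷ z ∷ []) ≈ eval q (z ∷ [])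
  eval-inZ []                  x y z = refl
  eval-inZ ((k , e ∷ []) ∷ q) x y z =
    +-cong (*-congˡ (trans (*-identityˡ _) (*-identityˡ _))) (eval-inZ q x y z)

  module _ {A : Set} (F G : A → ℕ) where

    eval-genPoly : (as : List A) (x y : Carrier) →
      eval (genPoly F G as) (x ∷ y ∷ []) ≈ ∑[ a ∈ as ] (pow x (F a) * pow y (G a))
    eval-genPoly []       x y = refl
    eval-genPoly (a ∷ as) x y =
      +-cong (trans (*-cong intR-1 (*-congˡ (*-identityʳ _))) (*-identityˡ _)) (eval-genPoly as x y)

    eval-∂y-genPoly : (as : List A) (x y : Carrier) →
      eval (∂ (suc zero) (genPoly F G as)) (x ∷ y ∷ [])
        ≈ ∑[ a ∈ as ] (natR (G a) * (pow x (F a) * pow y (G a ∸ 1)))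
    eval-∂y-genPoly []       x y = refl
    eval-∂y-genPoly (a ∷ as) x y = +-cong
      (*-cong (trans (intR-* (+ 1) (+ G a)) (trans (*-congʳ intR-1) (*-identityˡ _))) (*-congˡ (*-identityʳ _)))
      (eval-∂y-genPoly as x y)

    module _ (k : ℤ) where

      eval-⊖substY-genPoly : (as : List A) (x : Carrier) →
        eval (⊖ substY k (genPoly F G as)) (x ∷ [])
          ≈ - ∑[ a ∈ as ] (pow x (F a) * pow (intR k) (G a))
      eval-⊖substY-genPoly []       x = sym ε⁻¹≈ε
      eval-⊖substY-genPoly (a ∷ as) x = begin
        intR (ℤ.- (+ 1 ℤ.* k ℤ.^ G a)) * (pow x (F a) * 1#) + eval (⊖ substY k (genPoly F G as)) (x ∷ [])
          ≈⟨ +-cong (*-cong (intR-substY k (G a)) (*-identityʳ _)) (eval-⊖substY-genPoly as x) ⟩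
        - pow (intR k) (G a) * pow x (F a) + - rest
          ≈⟨ solve 3 (λ c b d → (:- c) :* b :+ (:- d) := :- (b :* c :+ d)) refl (pow (intR k) (G a)) (pow x (F a)) rest ⟩
        - (pow x (F a) * pow (intR k) (G a) + rest) ∎
        where rest = ∑[ a ∈ as ] (pow x (F a) * pow (intR k) (G a))

      eval-∂x⊖substY-genPoly : (as : List A) (x : Carrier) →
        eval (∂ zero (⊖ substY k (genPoly F G as))) (x ∷ [])
          ≈ - ∑[ a ∈ as ] (natR (F a) * (pow x (F a ∸ 1) * pow (intR k) (G a)))
      eval-∂x⊖substY-genPoly []       x = sym ε⁻¹≈ε
      eval-∂x⊖substY-genPoly (a ∷ as) x = begin
        intR (ℤ.- (+ 1 ℤ.* k ℤ.^ G a) ℤ.* + F a) * (pow x (F a ∸ 1) * 1#)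
          + eval (∂ zero (⊖ substY k (genPoly F G as))) (x ∷ [])
          ≈⟨ +-cong (*-cong (trans (intR-* (ℤ.- (+ 1 ℤ.* k ℤ.^ G a)) (+ F a)) (*-congʳ (intR-substY k (G a))))
                            (*-identityʳ _))
                    (eval-∂x⊖substY-genPoly as x) ⟩
        - pow (intR k) (G a) * natR (F a) * pow x (F a ∸ 1) + - rest
          ≈⟨ solve 4 (λ c m b d → (:- c) :* m :* b :+ (:- d) := :- (m :* (b :* c) :+ d))
                   refl (pow (intR k) (G a)) (natR (F a)) (pow x (F a ∸ 1)) rest ⟩
        - (natR (F a) * (pow x (F a ∸ 1) * pow (intR k) (G a)) + rest) ∎
        where rest = ∑[ a ∈ as ] (natR (F a) * (pow x (F a ∸ 1) * pow (intR k) (G a)))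

      eval-divX⊖substY-genPoly : (as : List A) (x : Carrier) →
        eval (divVar zero (⊖ substY k (genPoly F G as))) (x ∷ [])
          ≈ - ∑[ a ∈ as ] (divPow x (F a) * pow (intR k) (G a))
      eval-divX⊖substY-genPoly []       x = sym ε⁻¹≈ε
      eval-divX⊖substY-genPoly (a ∷ as) x with F a
      ... | zero = begin
        eval (divVar zero (⊖ substY k (genPoly F G as))) (x ∷ []) ≈⟨ eval-divX⊖substY-genPoly as x ⟩
        - rest                                                    ≈⟨ -‿cong (+-identityˡ rest) ⟨
        - (0# + rest)                                             ≈⟨ -‿cong (+-congʳ (zeroˡ _)) ⟨
        - (0# * pow (intR k) (G a) + rest)                        ∎
        where rest = ∑[ a ∈ as ] (divPow x (F a) * pow (intR k) (G a))
      ... | suc n = begin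
        intR (ℤ.- (+ 1 ℤ.* k ℤ.^ G a)) * (pow x n * 1#) + eval (divVar zero (⊖ substY k (genPoly F G as))) (x ∷ [])
          ≈⟨ +-cong (*-cong (intR-substY k (G a)) (*-identityʳ _)) (eval-divX⊖substY-genPoly as x) ⟩
        - pow (intR k) (G a) * pow x n + - rest
          ≈⟨ solve 3 (λ c b d → (:- c) :* b :+ (:- d) := :- (b :* c :+ d)) refl (pow (intR k) (G a)) (pow x n) rest ⟩
        - (pow x n * pow (intR k) (G a) + rest) ∎
        where rest = ∑[ a ∈ as ] (divPow x (F a) * pow (intR k) (G a))

  -- The generating functions as sums of multiplicative weights

  module AdmissibleSums (x y : Carrier) where

    weightA : Weight
    weightA s = 𝟙 (admissible s) * (pow x (size s) * pow y (length (boundary s)))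

    weightA-nothing : ∀ t → weightA {t} nothing ≈ y
    weightA-nothing t = trans (*-identityˡ _) (trans (*-identityˡ _) (*-identityʳ _))

    weightA-Ch : ∀ {ts} (cs : Ch ts) →
      𝟙 (noLeafCh cs) * (pow x (sizeCh cs) * pow y (length (bdCh cs))) ≈ ∏ch weightA cs
    weightA-Ch [] = trans (*-identityˡ _) (*-identityˡ _)
    weightA-Ch (_∷_ {t = t} nothing cs) = begin
      𝟙 (noLeafCh cs) * (pow x (sizeCh cs) * (y * pow y (length (bdCh cs))))
        ≈⟨ solve 4 (λ i a z b → i :* (a :* (z :* b)) := z :* (i :* (a :* b))) refl _ _ _ _ ⟩
      y * (𝟙 (noLeafCh cs) * (pow x (sizeCh cs) * pow y (length (bdCh cs))))
        ≈⟨ *-cong (sym (weightA-nothing t)) (weightA-Ch cs) ⟩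
      weightA {t} nothing * ∏ch weightA cs ∎
    weightA-Ch (just r ∷ cs) = begin
      𝟙 (noLeafRt r ∧ noLeafCh cs) * (pow x (sizeRt r ℕ.+ sizeCh cs) * pow y (length (bdRt r ++ bdCh cs)))
        ≈⟨ *-cong (𝟙-∧ (noLeafRt r) (noLeafCh cs))
                  (*-cong (pow-+ x (sizeRt r) (sizeCh cs)) (pow-length-++ y (bdRt r) (bdCh cs))) ⟩
      (𝟙 (noLeafRt r) * 𝟙 (noLeafCh cs))
        * ((pow x (sizeRt r) * pow x (sizeCh cs)) * (pow y (length (bdRt r)) * pow y (length (bdCh cs))))
        ≈⟨ solve 6 (λ i j a b d e → (i :* j) :* ((a :* b) :* (d :* e)) := (i :* (a :* d)) :* (j :* (b :* e)))
                 refl _ _ _ _ _ _ ⟩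
      weightA (just r) * (𝟙 (noLeafCh cs) * (pow x (sizeCh cs) * pow y (length (bdCh cs))))
        ≈⟨ *-congˡ (weightA-Ch cs) ⟩
      weightA (just r) * ∏ch weightA cs ∎

    sumA : Tree → Carrier
    sumA t = ∑-subtrees t weightA

    sumA-leaf : sumA (node []) ≈ y
    sumA-leaf = trans (∑-subtrees-node [] weightA)
      (trans (+-cong (weightA-nothing (node [])) (trans (+-identityʳ _) (zeroˡ _))) (+-identityʳ _))

    sumA-node : ∀ u us → sumA (node (u ∷ us)) ≈ y + x * ∏ (u ∷ us) sumA
    sumA-node u us = begin
      sumA (node (u ∷ us))
        ≈⟨ ∑-subtrees-node (u ∷ us) weightA ⟩
      weightA {node (u ∷ us)} nothing + ∑[ cs ∈ allCh (u ∷ us) ] weightA (just (rt cs))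
        ≈⟨ +-cong (weightA-nothing (node (u ∷ us))) (∑-cong (allCh (u ∷ us)) weightA-root) ⟩
      y + ∑[ cs ∈ allCh (u ∷ us) ] (x * ∏ch weightA cs)
        ≈⟨ +-congˡ (∑-*ˡ (allCh (u ∷ us)) x (∏ch weightA)) ⟩
      y + x * ∑ (allCh (u ∷ us)) (∏ch weightA)
        ≈⟨ +-congˡ (*-congˡ (∑-∏ch weightA (u ∷ us))) ⟩
      y + x * ∏ (u ∷ us) sumA ∎
      where
      weightA-root : (cs : Ch (u ∷ us)) → weightA (just (rt cs)) ≈ x * ∏ch weightA cs
      weightA-root (c ∷ cs) = trans (solve 4 (λ i z a b → i :* ((z :* a) :* b) := z :* (i :* (a :* b))) refl _ _ _ _)
                                    (*-congˡ (weightA-Ch (c ∷ cs)))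

  module LeafInducedSums (x y : Carrier) where

    weightP : Weight
    weightP s = 𝟙 (leafInduced s) * (pow x (size s) * pow y (leaves s))

    weightP/x : Weight
    weightP/x s = 𝟙 (leafInduced s) * (divPow x (size s) * pow y (leaves s))

    weightP′ : Weight
    weightP′ s = 𝟙 (leafInduced s) * (pow′ x (size s) * pow y (leaves s))

    sumP sumP/x sumP′ : Tree → Carrier
    sumP  t = ∑-subtrees t weightP
    sumP/x t = ∑-subtrees t weightP/x
    sumP′ t = ∑-subtrees t weightP′

    termQ : ∀ {ts} → Ch ts → Carrier
    termQ cs = 𝟙 (leafIndRt (rt cs)) * (pow x (sizeCh cs) * pow y (leavesRt (rt cs)))

    termQ′ : ∀ {ts} → Ch ts → Carrier
    termQ′ cs = 𝟙 (leafIndRt (rt cs)) * (pow′ x (sizeCh cs) * pow y (leavesRt (rt cs)))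

    sumQ sumQ′ : Tree → Carrier
    sumQ  (node ts) = ∑ (allCh ts) termQ
    sumQ′ (node ts) = ∑ (allCh ts) termQ′

    sumP-Q : ∀ t → sumP t ≈ 1# + x * sumQ t
    sumP-Q (node ts) = begin
      sumP (node ts)
        ≈⟨ ∑-subtrees-node ts weightP ⟩
      weightP {node ts} nothing + ∑[ cs ∈ allCh ts ] weightP (just (rt cs))
        ≈⟨ +-cong (trans (*-identityˡ _) (*-identityˡ _))
                  (∑-cong (allCh ts) (λ cs → solve 4 (λ i z a b → i :* ((z :* a) :* b) := z :* (i :* (a :* b))) refl _ _ _ _)) ⟩
      1# + ∑[ cs ∈ allCh ts ] (x * termQ cs)
        ≈⟨ +-congˡ (∑-*ˡ (allCh ts) x termQ) ⟩
      1# + x * sumQ (node ts) ∎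

    sumP/x-Q : ∀ t → sumP/x t ≈ sumQ t
    sumP/x-Q (node ts) =
      trans (∑-subtrees-node ts weightP/x) (trans (+-congʳ (trans (*-identityˡ _) (zeroˡ _))) (+-identityˡ _))

    weightP′-nothing : ∀ t → weightP′ {t} nothing ≈ 0#
    weightP′-nothing t = trans (*-identityˡ _) (trans (*-congʳ (pow′-zero x)) (zeroˡ _))

    sumP′-Q : ∀ t → sumP′ t ≈ sumQ t + x * sumQ′ t
    sumP′-Q (node ts) = begin
      sumP′ (node ts)
        ≈⟨ ∑-subtrees-node ts weightP′ ⟩
      weightP′ {node ts} nothing + ∑[ cs ∈ allCh ts ] weightP′ (just (rt cs))
        ≈⟨ +-cong (weightP′-nothing (node ts)) (∑-cong (allCh ts) weightP′-root) ⟩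
      0# + ∑[ cs ∈ allCh ts ] (termQ cs + x * termQ′ cs)
        ≈⟨ +-identityˡ _ ⟩
      ∑[ cs ∈ allCh ts ] (termQ cs + x * termQ′ cs)
        ≈⟨ ∑-+ (allCh ts) _ _ ⟩
      sumQ (node ts) + ∑[ cs ∈ allCh ts ] (x * termQ′ cs)
        ≈⟨ +-congˡ (∑-*ˡ (allCh ts) x termQ′) ⟩
      sumQ (node ts) + x * sumQ′ (node ts) ∎
      where
      weightP′-root : (cs : Ch ts) → weightP′ (just (rt cs)) ≈ termQ cs + x * termQ′ cs
      weightP′-root cs = trans (*-congˡ (*-congʳ (pow′-suc x (sizeCh cs))))
        (solve 5 (λ i a z d b → i :* ((a :+ z :* d) :* b) := i :* (a :* b) :+ z :* (i :* (d :* b))) refl _ _ _ _ _)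

    sumQ-leaf : sumQ (node []) ≈ y
    sumQ-leaf = trans (+-identityʳ _) (trans (*-identityˡ _) (trans (*-identityˡ _) (*-identityʳ _)))

    sumQ′-leaf : sumQ′ (node []) ≈ 0#
    sumQ′-leaf = trans (+-identityʳ _) (trans (*-identityˡ _) (trans (*-congʳ (pow′-zero x)) (zeroˡ _)))

    weightCh : ∀ {ts} → Ch ts → Carrier
    weightCh cs = 𝟙 (leafIndCh cs) * (pow x (sizeCh cs) * pow y (leavesCh cs))

    weightCh′ : ∀ {ts} → Ch ts → Carrier
    weightCh′ cs = 𝟙 (leafIndCh cs) * (pow′ x (sizeCh cs) * pow y (leavesCh cs))

    weightCh-∏ch : ∀ {ts} (cs : Ch ts) → weightCh cs ≈ ∏ch weightP cs
    weightCh-∏ch []             = trans (*-identityˡ _) (*-identityˡ _)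
    weightCh-∏ch (nothing ∷ cs) =
      trans (weightCh-∏ch cs) (sym (trans (*-congʳ (trans (*-identityˡ _) (*-identityˡ _))) (*-identityˡ _)))
    weightCh-∏ch (just r ∷ cs) = begin
      𝟙 (leafIndRt r ∧ leafIndCh cs) * (pow x (sizeRt r ℕ.+ sizeCh cs) * pow y (leavesRt r ℕ.+ leavesCh cs))
        ≈⟨ *-cong (𝟙-∧ (leafIndRt r) (leafIndCh cs))
                  (*-cong (pow-+ x (sizeRt r) (sizeCh cs)) (pow-+ y (leavesRt r) (leavesCh cs))) ⟩
      (𝟙 (leafIndRt r) * 𝟙 (leafIndCh cs))
        * ((pow x (sizeRt r) * pow x (sizeCh cs)) * (pow y (leavesRt r) * pow y (leavesCh cs)))
        ≈⟨ solve 6 (λ i j a b d e → (i :* j) :* ((a :* b) :* (d :* e)) := (i :* (a :* d)) :* (j :* (b :* e)))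
                 refl _ _ _ _ _ _ ⟩
      weightP (just r) * weightCh cs
        ≈⟨ *-congˡ (weightCh-∏ch cs) ⟩
      weightP (just r) * ∏ch weightP cs ∎

    weightCh′-∂∏ch : ∀ {ts} (cs : Ch ts) → weightCh′ cs ≈ ∂∏ch weightP weightP′ cs
    weightCh′-∂∏ch [] = trans (*-identityˡ _) (trans (*-congʳ (pow′-zero x)) (zeroˡ _))
    weightCh′-∂∏ch (_∷_ {t = t} nothing cs) = begin
      weightCh′ cs
        ≈⟨ weightCh′-∂∏ch cs ⟩
      ∂∏ch weightP weightP′ cs
        ≈⟨ trans (+-identityˡ _) (*-identityˡ _) ⟨
      0# + 1# * ∂∏ch weightP weightP′ cs
        ≈⟨ +-cong (trans (*-congʳ (weightP′-nothing t)) (zeroˡ _)) (*-congʳ (trans (*-identityˡ _) (*-identityˡ _))) ⟨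
      weightP′ {t} nothing * ∏ch weightP cs + weightP {t} nothing * ∂∏ch weightP weightP′ cs ∎
    weightCh′-∂∏ch (just r ∷ cs) = begin
      𝟙 (leafIndRt r ∧ leafIndCh cs) * (pow′ x (sizeRt r ℕ.+ sizeCh cs) * pow y (leavesRt r ℕ.+ leavesCh cs))
        ≈⟨ *-cong (𝟙-∧ (leafIndRt r) (leafIndCh cs))
                  (*-cong (pow′-+ x (sizeRt r) (sizeCh cs)) (pow-+ y (leavesRt r) (leavesCh cs))) ⟩
      (𝟙 (leafIndRt r) * 𝟙 (leafIndCh cs))
        * ((pow′ x (sizeRt r) * pow x (sizeCh cs) + pow x (sizeRt r) * pow′ x (sizeCh cs))
           * (pow y (leavesRt r) * pow y (leavesCh cs)))
        ≈⟨ solve 8 (λ i j da b a db d e → (i :* j) :* ((da :* b :+ a :* db) :* (d :* e))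
                                         := (i :* (da :* d)) :* (j :* (b :* e)) :+ (i :* (a :* d)) :* (j :* (db :* e)))
                 refl _ _ _ _ _ _ _ _ ⟩
      weightP′ (just r) * weightCh cs + weightP (just r) * weightCh′ cs
        ≈⟨ +-cong (*-congˡ (weightCh-∏ch cs)) (*-congˡ (weightCh′-∂∏ch cs)) ⟩
      weightP′ (just r) * ∏ch weightP cs + weightP (just r) * ∂∏ch weightP weightP′ cs ∎

    isEmpty : Weight
    isEmpty nothing  = 1#
    isEmpty (just _) = 0#

    ∑-subtrees-isEmpty : ∀ t → ∑-subtrees t isEmpty ≈ 1#
    ∑-subtrees-isEmpty t = trans (+-congˡ (trans (∑-map (allRt t) just isEmpty) (∑-0# (allRt t)))) (+-identityʳ _)

    𝟙-anyInclCh : ∀ {ts} (cs : Ch ts) → 𝟙 (anyInclCh cs) * weightCh cs ≈ weightCh cs + - ∏ch isEmpty cs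
    𝟙-anyInclCh [] = begin
      0# * weightCh {[]} []       ≈⟨ zeroˡ _ ⟩
      0#                          ≈⟨ -‿inverseʳ 1# ⟨
      1# + - 1#                   ≈⟨ +-congʳ (trans (*-identityˡ _) (*-identityˡ _)) ⟨
      weightCh {[]} [] + - 1#     ∎
    𝟙-anyInclCh (nothing ∷ cs) = trans (𝟙-anyInclCh cs) (+-congˡ (-‿cong (sym (*-identityˡ _))))
    𝟙-anyInclCh (just r ∷ cs)  = begin
      1# * weightCh (just r ∷ cs)              ≈⟨ *-identityˡ _ ⟩
      weightCh (just r ∷ cs)                   ≈⟨ +-identityʳ _ ⟨
      weightCh (just r ∷ cs) + 0#              ≈⟨ +-congˡ (trans (-‿cong (zeroˡ _)) ε⁻¹≈ε) ⟨
      weightCh (just r ∷ cs) + - (0# * ∏ch isEmpty cs) ∎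

    termQ-anyInclCh : ∀ {u us} (cs : Ch (u ∷ us)) → termQ cs ≈ 𝟙 (anyInclCh cs) * weightCh cs
    termQ-anyInclCh (c ∷ cs) with anyInclCh (c ∷ cs)
    ... | true  = sym (*-identityˡ _)
    ... | false = trans (zeroˡ _) (sym (zeroˡ _))

    sizeCh-noneIncluded : ∀ {ts} (cs : Ch ts) → anyInclCh cs ≡ false → sizeCh cs ≡ 0
    sizeCh-noneIncluded []             _  = ≡.refl
    sizeCh-noneIncluded (nothing ∷ cs) eq = sizeCh-noneIncluded cs eq
    sizeCh-noneIncluded (just r ∷ cs)  ()

    termQ′-weightCh′ : ∀ {u us} (cs : Ch (u ∷ us)) → termQ′ cs ≈ weightCh′ cs
    termQ′-weightCh′ (c ∷ cs) with anyInclCh (c ∷ cs) in none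
    ... | true  = refl
    ... | false = begin
      0# * _        ≈⟨ zeroˡ _ ⟩
      0#            ≈⟨ trans (*-congˡ (trans (*-congʳ pow′-size) (zeroˡ _))) (zeroʳ _) ⟨
      weightCh′ (c ∷ cs) ∎
      where
      pow′-size : pow′ x (sizeCh (c ∷ cs)) ≈ 0#
      pow′-size = trans (reflexive (≡.cong (pow′ x) (sizeCh-noneIncluded (c ∷ cs) none))) (pow′-zero x)

    -- ∏ P also counts the choice of keeping no child, which contributes 1 but is not
    -- leaf-induced at an inner vertex.
    sumQ-node : ∀ u us → sumQ (node (u ∷ us)) ≈ ∏ (u ∷ us) sumP + - 1#
    sumQ-node u us = begin
      ∑ (allCh (u ∷ us)) termQ
        ≈⟨ ∑-cong (allCh (u ∷ us))
             (λ cs → trans (termQ-anyInclCh cs) (trans (𝟙-anyInclCh cs) (+-congʳ (weightCh-∏ch cs)))) ⟩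
      ∑[ cs ∈ allCh (u ∷ us) ] (∏ch weightP cs + - ∏ch isEmpty cs)
        ≈⟨ trans (∑-+ (allCh (u ∷ us)) _ _) (+-congˡ (∑-neg (allCh (u ∷ us)) _)) ⟩
      ∑ (allCh (u ∷ us)) (∏ch weightP) + - ∑ (allCh (u ∷ us)) (∏ch isEmpty)
        ≈⟨ +-cong (∑-∏ch weightP (u ∷ us))
                  (-‿cong (trans (∑-∏ch isEmpty (u ∷ us)) (∏-1# (u ∷ us) ∑-subtrees-isEmpty))) ⟩
      ∏ (u ∷ us) sumP + - 1# ∎

    sumQ′-node : ∀ u us → sumQ′ (node (u ∷ us)) ≈ ∂∏ (u ∷ us) sumP sumP′
    sumQ′-node u us = trans (∑-cong (allCh (u ∷ us)) (λ cs → trans (termQ′-weightCh′ cs) (weightCh′-∂∏ch cs)))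
                            (∑-∂∏ch weightP weightP′ (u ∷ us))

  module MarkedSums (x y : Carrier) (q : Tree → Carrier) where
    open AdmissibleSums x y

    boundaryTerm : List Tree → Carrier
    boundaryTerm L = pow y (length L ∸ 1) * ∑ L q

    weightM : Weight
    weightM s = 𝟙 (admissible s) * (pow x (size s) * boundaryTerm (boundary s))

    boundaryTerm-∷ : ∀ u L → boundaryTerm (u ∷ L) ≈ q u * pow y (length L) + y * boundaryTerm L
    boundaryTerm-∷ u [] = begin
      1# * (q u + 0#)              ≈⟨ trans (*-identityˡ _) (+-identityʳ _) ⟩
      q u                          ≈⟨ trans (+-congˡ (trans (*-congˡ (zeroʳ _)) (zeroʳ _))) (trans (+-identityʳ _) (*-identityʳ _)) ⟨
      q u * 1# + y * (1# * 0#)     ∎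
    boundaryTerm-∷ u (w ∷ L) =
      solve 4 (λ a Y s z → (z :* Y) :* (a :+ s) := a :* (z :* Y) :+ z :* (Y :* s)) refl _ _ _ _

    boundaryTerm-++ : ∀ L L′ →
      boundaryTerm (L ++ L′) ≈ boundaryTerm L * pow y (length L′) + pow y (length L) * boundaryTerm L′
    boundaryTerm-++ [] L′ =
      sym (trans (+-cong (trans (*-congʳ (zeroʳ _)) (zeroˡ _)) (*-identityˡ _)) (+-identityˡ _))
    boundaryTerm-++ (u ∷ L) L′ = begin
      boundaryTerm (u ∷ (L ++ L′))
        ≈⟨ boundaryTerm-∷ u (L ++ L′) ⟩
      q u * pow y (length (L ++ L′)) + y * boundaryTerm (L ++ L′)
        ≈⟨ +-cong (*-congˡ (pow-length-++ y L L′)) (*-congˡ (boundaryTerm-++ L L′)) ⟩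
      q u * (pow y (length L) * pow y (length L′))
        + y * (boundaryTerm L * pow y (length L′) + pow y (length L) * boundaryTerm L′)
        ≈⟨ solve 6 (λ a b e z d f → a :* (b :* e) :+ z :* (d :* e :+ b :* f) := (a :* b :+ z :* d) :* e :+ (z :* b) :* f)
                 refl _ _ _ _ _ _ ⟩
      (q u * pow y (length L) + y * boundaryTerm L) * pow y (length L′) + (y * pow y (length L)) * boundaryTerm L′
        ≈⟨ +-congʳ (*-congʳ (boundaryTerm-∷ u L)) ⟨
      boundaryTerm (u ∷ L) * pow y (length L′) + pow y (length (u ∷ L)) * boundaryTerm L′ ∎

    weightM-nothing : ∀ t → weightM {t} nothing ≈ q t
    weightM-nothing t = trans (*-identityˡ _) (trans (*-identityˡ _) (trans (*-identityˡ _) (+-identityʳ _)))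

    weightM-Ch : ∀ {ts} (cs : Ch ts) →
      𝟙 (noLeafCh cs) * (pow x (sizeCh cs) * boundaryTerm (bdCh cs)) ≈ ∂∏ch weightA weightM cs
    weightM-Ch [] = trans (*-identityˡ _) (trans (*-identityˡ _) (zeroʳ _))
    weightM-Ch (_∷_ {t = t} nothing cs) = begin
      𝟙 (noLeafCh cs) * (pow x (sizeCh cs) * boundaryTerm (t ∷ bdCh cs))
        ≈⟨ *-congˡ (*-congˡ (boundaryTerm-∷ t (bdCh cs))) ⟩
      𝟙 (noLeafCh cs) * (pow x (sizeCh cs) * (q t * pow y (length (bdCh cs)) + y * boundaryTerm (bdCh cs)))
        ≈⟨ solve 6 (λ i a b e z d → i :* (a :* (b :* e :+ z :* d)) := b :* (i :* (a :* e)) :+ z :* (i :* (a :* d)))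
                 refl _ _ _ _ _ _ ⟩
      q t * (𝟙 (noLeafCh cs) * (pow x (sizeCh cs) * pow y (length (bdCh cs))))
        + y * (𝟙 (noLeafCh cs) * (pow x (sizeCh cs) * boundaryTerm (bdCh cs)))
        ≈⟨ +-cong (*-cong (sym (weightM-nothing t)) (weightA-Ch cs)) (*-cong (sym (weightA-nothing t)) (weightM-Ch cs)) ⟩
      weightM {t} nothing * ∏ch weightA cs + weightA {t} nothing * ∂∏ch weightA weightM cs ∎
    weightM-Ch (just r ∷ cs) = begin
      𝟙 (noLeafRt r ∧ noLeafCh cs) * (pow x (sizeRt r ℕ.+ sizeCh cs) * boundaryTerm (bdRt r ++ bdCh cs))
        ≈⟨ *-cong (𝟙-∧ (noLeafRt r) (noLeafCh cs))
                  (*-cong (pow-+ x (sizeRt r) (sizeCh cs)) (boundaryTerm-++ (bdRt r) (bdCh cs))) ⟩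
      (𝟙 (noLeafRt r) * 𝟙 (noLeafCh cs))
        * ((pow x (sizeRt r) * pow x (sizeCh cs))
           * (boundaryTerm (bdRt r) * pow y (length (bdCh cs)) + pow y (length (bdRt r)) * boundaryTerm (bdCh cs)))
        ≈⟨ solve 8 (λ i j a b D e d f → (i :* j) :* ((a :* b) :* (D :* e :+ d :* f))
                                       := (i :* (a :* D)) :* (j :* (b :* e)) :+ (i :* (a :* d)) :* (j :* (b :* f)))
                 refl _ _ _ _ _ _ _ _ ⟩
      weightM (just r) * (𝟙 (noLeafCh cs) * (pow x (sizeCh cs) * pow y (length (bdCh cs))))
        + weightA (just r) * (𝟙 (noLeafCh cs) * (pow x (sizeCh cs) * boundaryTerm (bdCh cs)))
        ≈⟨ +-cong (*-congˡ (weightA-Ch cs)) (*-congˡ (weightM-Ch cs)) ⟩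
      weightM (just r) * ∏ch weightA cs + weightA (just r) * ∂∏ch weightA weightM cs ∎

    sumM : Tree → Carrier
    sumM t = ∑-subtrees t weightM

    sumM-leaf : sumM (node []) ≈ q (node [])
    sumM-leaf = trans (∑-subtrees-node [] weightM)
      (trans (+-cong (weightM-nothing (node [])) (trans (+-identityʳ _) (zeroˡ _))) (+-identityʳ _))

    sumM-node : ∀ u us → sumM (node (u ∷ us)) ≈ q (node (u ∷ us)) + x * ∂∏ (u ∷ us) sumA sumM
    sumM-node u us = begin
      sumM (node (u ∷ us))
        ≈⟨ ∑-subtrees-node (u ∷ us) weightM ⟩
      weightM {node (u ∷ us)} nothing + ∑[ cs ∈ allCh (u ∷ us) ] weightM (just (rt cs))
        ≈⟨ +-cong (weightM-nothing (node (u ∷ us))) (∑-cong (allCh (u ∷ us)) weightM-root) ⟩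
      q (node (u ∷ us)) + ∑[ cs ∈ allCh (u ∷ us) ] (x * ∂∏ch weightA weightM cs)
        ≈⟨ +-congˡ (∑-*ˡ (allCh (u ∷ us)) x (∂∏ch weightA weightM)) ⟩
      q (node (u ∷ us)) + x * ∑ (allCh (u ∷ us)) (∂∏ch weightA weightM)
        ≈⟨ +-congˡ (*-congˡ (∑-∂∏ch weightA weightM (u ∷ us))) ⟩
      q (node (u ∷ us)) + x * ∂∏ (u ∷ us) sumA sumM ∎
      where
      weightM-root : (cs : Ch (u ∷ us)) → weightM (just (rt cs)) ≈ x * ∂∏ch weightA weightM cs
      weightM-root (c ∷ cs) = trans (solve 4 (λ i z a D → i :* ((z :* a) :* D) := z :* (i :* (a :* D))) refl _ _ _ _)
                                    (*-congˡ (weightM-Ch (c ∷ cs)))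

  -- The value -1 that substY produces: intR (ℤ.- (+ 1)) is - (1# + 0#), not - 1#.
  -1ᶻ : Carrier
  -1ᶻ = intR (ℤ.- (+ 1))

  -1ᶻ≈-1# : -1ᶻ ≈ - 1#
  -1ᶻ≈-1# = -‿cong intR-1

  p/x : Carrier → Tree → Carrier
  p/x z v = eval (divVar zero (p v)) (z ∷ [])

  eval-A : ∀ t x y → eval (A t) (x ∷ y ∷ []) ≈ AdmissibleSums.sumA x y t
  eval-A t x y = trans (eval-genPoly size (λ s → length (boundary s)) (allAdmissible t) x y)
                       (∑-filter (allSubtrees t) admissible _)

  eval-∂yA : ∀ t x y → eval (∂ (suc zero) (A t)) (x ∷ y ∷ [])
    ≈ ∑[ s ∈ allAdmissible t ] (natR (length (boundary s)) * (pow x (size s) * pow y (length (boundary s) ∸ 1)))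
  eval-∂yA t x y = eval-∂y-genPoly size (λ s → length (boundary s)) (allAdmissible t) x y

  eval-p : ∀ t x → eval (p t) (x ∷ []) ≈ 1# + - LeafInducedSums.sumP x -1ᶻ t
  eval-p t x = trans (+-cong (trans (*-cong intR-1 (*-identityʳ _)) (*-identityʳ _))
                             (eval-⊖substY-genPoly size leaves (ℤ.- (+ 1)) (allLeafInduced t) x))
                     (+-congˡ (-‿cong (∑-filter (allSubtrees t) leafInduced _)))

  eval-∂xp : ∀ t x → eval (∂ zero (p t)) (x ∷ []) ≈ - LeafInducedSums.sumP′ x -1ᶻ t
  eval-∂xp t x = trans (+-cong (zeroˡ _) (eval-∂x⊖substY-genPoly size leaves (ℤ.- (+ 1)) (allLeafInduced t) x))
    (trans (+-identityˡ _) (-‿cong (trans (∑-filter (allSubtrees t) leafInduced _)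
       (∑-cong (allSubtrees t) (λ s → *-congˡ (sym (*-assoc _ _ _)))))))

  eval-p/x : ∀ v z → p/x z v ≈ - LeafInducedSums.sumQ z -1ᶻ v
  eval-p/x v z = trans (eval-divX⊖substY-genPoly size leaves (ℤ.- (+ 1)) (allLeafInduced v) z)
    (-‿cong (trans (∑-filter (allSubtrees v) leafInduced _) (LeafInducedSums.sumP/x-Q z -1ᶻ v)))

  eval-M : ∀ t x y z → eval (M t) (x ∷ y ∷ z ∷ [])
    ≈ ∑[ s ∈ allAdmissible t ] (pow x (size s) * MarkedSums.boundaryTerm x y (p/x z) (boundary s))
  eval-M t x y z =
    trans (eval-ΣP (allAdmissible t) summand (x ∷ y ∷ z ∷ [])) (∑-cong (allAdmissible t) eval-summand)
    where
    open MarkedSums x y (p/x z) using (boundaryTerm)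

    summand : Subtree t → Poly 3
    summand s = ((+ 1 , size s ∷ (length (boundary s) ∸ 1) ∷ 0 ∷ []) ∷ [])
                ⊗ ΣP (boundary s) (λ v → inZ (divVar zero (p v)))

    eval-summand : ∀ s → eval (summand s) (x ∷ y ∷ z ∷ []) ≈ pow x (size s) * boundaryTerm (boundary s)
    eval-summand s = begin
      eval (summand s) (x ∷ y ∷ z ∷ [])
        ≈⟨ eval-monomial-⊗ (+ 1) _ (ΣP (boundary s) (λ v → inZ (divVar zero (p v)))) (x ∷ y ∷ z ∷ []) ⟩
      (intR (+ 1) * (pow x (size s) * (pow y (length (boundary s) ∸ 1) * (1# * 1#))))
        * eval (ΣP (boundary s) (λ v → inZ (divVar zero (p v)))) (x ∷ y ∷ z ∷ [])
        ≈⟨ *-cong (trans (*-congʳ intR-1) (trans (*-identityˡ _) (*-congˡ (trans (*-congˡ (*-identityˡ _)) (*-identityʳ _)))))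
                  (trans (eval-ΣP (boundary s) _ _) (∑-cong (boundary s) (λ v → eval-inZ (divVar zero (p v)) x y z))) ⟩
      (pow x (size s) * pow y (length (boundary s) ∸ 1)) * ∑ (boundary s) (p/x z)
        ≈⟨ *-assoc _ _ _ ⟩
      pow x (size s) * boundaryTerm (boundary s) ∎

  -- The three identities

  sumQ-at-1 : ∀ v → LeafInducedSums.sumQ 1# -1ᶻ v ≈ - 1#
  sumQ-at-1 (node [])       = trans sumQ-leaf -1ᶻ≈-1#
    where open LeafInducedSums 1# -1ᶻ
  sumQ-at-1 (node (u ∷ us)) = begin
    sumQ (node (u ∷ us))          ≈⟨ sumQ-node u us ⟩
    sumP u * ∏ us sumP + - 1#     ≈⟨ +-congʳ (*-congʳ sumP-u) ⟩
    0# * ∏ us sumP + - 1#         ≈⟨ +-congʳ (zeroˡ _) ⟩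
    0# + - 1#                     ≈⟨ +-identityˡ _ ⟩
    - 1#                          ∎
    where
    open LeafInducedSums 1# -1ᶻ
    sumP-u : sumP u ≈ 0#
    sumP-u = trans (sumP-Q u) (trans (+-congˡ (trans (*-identityˡ _) (sumQ-at-1 u))) (-‿inverseʳ 1#))

  M-at-z=1 : ∀ T x y → eval (M T) (x ∷ y ∷ 1# ∷ []) ≈ eval (∂ (suc zero) (A T)) (x ∷ y ∷ [])
  M-at-z=1 T x y = trans (eval-M T x y 1#) (trans (∑-cong (allAdmissible T) summand-at-1) (sym (eval-∂yA T x y)))
    where
    p/x-at-1 : ∀ v → p/x 1# v ≈ 1#
    p/x-at-1 v = trans (eval-p/x v 1#) (trans (-‿cong (sumQ-at-1 v)) (⁻¹-involutive 1#))
    open MarkedSums x y (p/x 1#) using (boundaryTerm)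

    summand-at-1 : (s : Subtree T) → pow x (size s) * boundaryTerm (boundary s)
      ≈ natR (length (boundary s)) * (pow x (size s) * pow y (length (boundary s) ∸ 1))
    summand-at-1 s = begin
      pow x (size s) * (pow y (length (boundary s) ∸ 1) * ∑ (boundary s) (p/x 1#))
        ≈⟨ *-congˡ (*-congˡ (∑-1# (boundary s) p/x-at-1)) ⟩
      pow x (size s) * (pow y (length (boundary s) ∸ 1) * natR (length (boundary s)))
        ≈⟨ solve 3 (λ a b n → a :* (b :* n) := n :* (a :* b)) refl _ _ _ ⟩
      natR (length (boundary s)) * (pow x (size s) * pow y (length (boundary s) ∸ 1)) ∎

  x*-1≈-x : ∀ x → x * - 1# ≈ - x
  x*-1≈-x x = trans (sym (-‿distribʳ-* x 1#)) (-‿cong (*-identityʳ x))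

  1-x+x*P≈1+x*[P-1] : ∀ x P → (1# + - x) + x * P ≈ 1# + x * (P + - 1#)
  1-x+x*P≈1+x*[P-1] x P = begin
    (1# + - x) + x * P         ≈⟨ solve 3 (λ o z a → (o :+ :- z) :+ z :* a := o :+ (z :* a :+ :- z)) refl 1# x P ⟩
    1# + (x * P + - x)         ≈⟨ +-congˡ (+-congˡ (x*-1≈-x x)) ⟨
    1# + (x * P + x * - 1#)    ≈⟨ +-congˡ (distribˡ x P (- 1#)) ⟨
    1# + x * (P + - 1#)        ∎

  module OnAntidiagonal (x : Carrier) where
    open AdmissibleSums x (1# + - x)
    open LeafInducedSums x -1ᶻ

    mutual
      sumA≈sumP : ∀ t → sumA t ≈ sumP t
      sumA≈sumP (node []) = begin
        sumA (node [])            ≈⟨ sumA-leaf ⟩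
        1# + - x                  ≈⟨ +-congˡ (x*-1≈-x x) ⟨
        1# + x * - 1#             ≈⟨ +-congˡ (*-congˡ (trans sumQ-leaf -1ᶻ≈-1#)) ⟨
        1# + x * sumQ (node [])   ≈⟨ sumP-Q (node []) ⟨
        sumP (node [])            ∎
      sumA≈sumP (node (u ∷ us)) = begin
        sumA (node (u ∷ us))                      ≈⟨ sumA-node u us ⟩
        (1# + - x) + x * ∏ (u ∷ us) sumA          ≈⟨ +-congˡ (*-congˡ (∏-sumA≈∏-sumP (u ∷ us))) ⟩
        (1# + - x) + x * ∏ (u ∷ us) sumP          ≈⟨ 1-x+x*P≈1+x*[P-1] x _ ⟩
        1# + x * (∏ (u ∷ us) sumP + - 1#)         ≈⟨ +-congˡ (*-congˡ (sumQ-node u us)) ⟨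
        1# + x * sumQ (node (u ∷ us))             ≈⟨ sumP-Q (node (u ∷ us)) ⟨
        sumP (node (u ∷ us))                      ∎

      ∏-sumA≈∏-sumP : ∀ ts → ∏ ts sumA ≈ ∏ ts sumP
      ∏-sumA≈∏-sumP []       = refl
      ∏-sumA≈∏-sumP (t ∷ ts) = *-cong (sumA≈sumP t) (∏-sumA≈∏-sumP ts)

    open MarkedSums x (1# + - x) (p/x x) using (sumM; sumM-leaf; sumM-node)

    -a+x*-b≈-[a+x*b] : ∀ a b → - a + x * - b ≈ - (a + x * b)
    -a+x*-b≈-[a+x*b] = solve 3 (λ z a b → :- a :+ z :* (:- b) := :- (a :+ z :* b)) refl x

    mutual
      sumM≈-sumP′ : ∀ t → sumM t ≈ - sumP′ t
      sumM≈-sumP′ (node []) = begin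
        sumM (node [])                            ≈⟨ sumM-leaf ⟩
        p/x x (node [])                           ≈⟨ eval-p/x (node []) x ⟩
        - sumQ (node [])                          ≈⟨ -‿cong (+-identityʳ _) ⟨
        - (sumQ (node []) + 0#)                   ≈⟨ -‿cong (+-congˡ (trans (*-congˡ sumQ′-leaf) (zeroʳ x))) ⟨
        - (sumQ (node []) + x * sumQ′ (node []))  ≈⟨ -‿cong (sumP′-Q (node [])) ⟨
        - sumP′ (node [])                         ∎
      sumM≈-sumP′ (node (u ∷ us)) = begin
        sumM (node (u ∷ us))
          ≈⟨ sumM-node u us ⟩
        p/x x (node (u ∷ us)) + x * ∂∏ (u ∷ us) sumA sumM
          ≈⟨ +-cong (eval-p/x (node (u ∷ us)) x) (*-congˡ (∂∏-sumM≈-∂∏-sumP′ (u ∷ us))) ⟩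
        - sumQ (node (u ∷ us)) + x * - ∂∏ (u ∷ us) sumP sumP′
          ≈⟨ -a+x*-b≈-[a+x*b] _ _ ⟩
        - (sumQ (node (u ∷ us)) + x * ∂∏ (u ∷ us) sumP sumP′)
          ≈⟨ -‿cong (+-congˡ (*-congˡ (sumQ′-node u us))) ⟨
        - (sumQ (node (u ∷ us)) + x * sumQ′ (node (u ∷ us)))
          ≈⟨ -‿cong (sumP′-Q (node (u ∷ us))) ⟨
        - sumP′ (node (u ∷ us)) ∎

      ∂∏-sumM≈-∂∏-sumP′ : ∀ ts → ∂∏ ts sumA sumM ≈ - ∂∏ ts sumP sumP′
      ∂∏-sumM≈-∂∏-sumP′ []       = sym ε⁻¹≈ε
      ∂∏-sumM≈-∂∏-sumP′ (t ∷ ts) = begin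
        sumM t * ∏ ts sumA + sumA t * ∂∏ ts sumA sumM
          ≈⟨ +-cong (*-cong (sumM≈-sumP′ t) (∏-sumA≈∏-sumP ts)) (*-cong (sumA≈sumP t) (∂∏-sumM≈-∂∏-sumP′ ts)) ⟩
        - sumP′ t * ∏ ts sumP + sumP t * - ∂∏ ts sumP sumP′
          ≈⟨ solve 4 (λ a b d e → (:- a) :* b :+ d :* (:- e) := :- (a :* b :+ d :* e)) refl _ _ _ _ ⟩
        - ∂∏ (t ∷ ts) sumP sumP′ ∎

  A-at-y=1-x : ∀ T x → eval (A T) (x ∷ (1# + - x) ∷ []) ≈ 1# + - eval (p T) (x ∷ [])
  A-at-y=1-x T x = begin
    eval (A T) (x ∷ (1# + - x) ∷ [])     ≈⟨ eval-A T x (1# + - x) ⟩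
    AdmissibleSums.sumA x (1# + - x) T   ≈⟨ OnAntidiagonal.sumA≈sumP x T ⟩
    sumP T                               ≈⟨ solve 2 (λ o a → a := o :+ :- (o :+ :- a)) refl 1# (sumP T) ⟩
    1# + - (1# + - sumP T)               ≈⟨ +-congˡ (-‿cong (eval-p T x)) ⟨
    1# + - eval (p T) (x ∷ [])           ∎
    where open LeafInducedSums x -1ᶻ using (sumP)

  M-at-y=1-x-z=x : ∀ T x → eval (M T) (x ∷ (1# + - x) ∷ x ∷ []) ≈ eval (∂ zero (p T)) (x ∷ [])
  M-at-y=1-x-z=x T x = begin
    eval (M T) (x ∷ (1# + - x) ∷ x ∷ [])
      ≈⟨ trans (eval-M T x (1# + - x) x) (∑-filter (allSubtrees T) admissible _) ⟩
    MarkedSums.sumM x (1# + - x) (p/x x) T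
      ≈⟨ OnAntidiagonal.sumM≈-sumP′ x T ⟩
    - LeafInducedSums.sumP′ x -1ᶻ T
      ≈⟨ eval-∂xp T x ⟨
    eval (∂ zero (p T)) (x ∷ []) ∎

lemma4p5 : ∀ {c ℓ : Level} (R : CommutativeRing c ℓ) (T : Tree) →
    let open Eval R
    in ((x y : Carrier) → eval (M T) (x ∷ y ∷ 1# ∷ []) ≈ eval (∂ (suc zero) (A T)) (x ∷ y ∷ []))
       × ((x : Carrier) → eval (A T) (x ∷ (1# + - x) ∷ []) ≈ 1# + - eval (p T) (x ∷ []))
       × ((x : Carrier) → eval (M T) (x ∷ (1# + - x) ∷ x ∷ []) ≈ eval (∂ zero (p T)) (x ∷ []))
lemma4p5 R T = M-at-z=1 R T , A-at-y=1-x R T , M-at-y=1-x-z=x R T
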